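{- Let $G$ be a triangulation of a closed surface that contains a vertex whose neighbourhood (the subgraph induced by its neighbours) is not bipartite. Then $G$ is not $t$-perfect, $G$ is not strongly $t$-perfect, $G$ is not both perfect and $K_4$-free, and $G$ contains a loose odd wheel or an induced $\overline{C_7}$.
   Context: A triangulation of a closed surface is a finite simple graph embedded in the surface such that every face is bounded by a $3$-cycle. For a graph $G=(V,E)$, $\mathrm{SSP}(G)$ is the convex hull of the characteristic vectors of stable sets; $\mathrm{TSTAB}(G)$ is defined by $x\ge0$, $x_u+x_v\le1$ for every edge $uv$, and $\sum_{v\in V(C)}x_v\le\lfloor|C|/2\rfloor$ for every induced odd cycle $C$. $G$ is $t$-perfect if $\mathrm{SSP}(G)=\mathrm{TSTAB}(G)$ and strongly $t$-perfect if this system is totally dual integral. A graph is perfect if every induced subgraph has chromatic number equal to clique number. For a cycle $C$ and $v_1,v_2,v_3\in V(C)$, $C[v_1,v_2]_{v_3}$ is the path along $C$ from $v_1$ to $v_2$ avoiding $v_3$. For an odd cycle $C$ and a vertex $v\notin V(C)$, three neighbours $v_1,v_2,v_3$ of $v$ on $C$ are three odd neighbours if $C[v_1,v_2]_{v_3}$, $C[v_1,v_3]_{v_2}$, $C[v_2,v_3]_{v_1}$ are all odd. A loose odd wheel consists of an odd cycle $C$ and a vertex $v\notin V(C)$ with three odd neighbours on $C$. $\overline{C_7}$ is the complement of the $7$-cycle. -}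

module Defs where

open import Data.Nat as ℕ using (ℕ; zero; suc; _∸_)
open import Data.Nat.DivMod using (_/_)
open import Data.Integer as ℤ using (ℤ; +_)
open import Data.Rational as ℚ using (ℚ; 0ℚ; 1ℚ)
open import Data.Fin as Fin using (Fin; toℕ)
open import Data.Bool using (Bool; true; false; if_then_else_)
open import Data.List as List using (List; []; _∷_; map; foldr; allFin; length)
open import Data.List.Membership.Propositional using (_∈_)
open import Data.List.Relation.Unary.All using (All)
open import Data.Product using (Σ; ∃; ∃-syntax; _×_; _,_; proj₁; proj₂)
open import Data.Sum using (_⊎_)
open import Relation.Binary.PropositionalEquality using (_≡_; _≢_)
open import Relation.Binary.Construct.Closure.ReflexiveTransitive using (Star)
open import Relation.Nullary using (¬_; yes; no)
open import Function.Bundles using (_⇔_)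

Odd : ℕ → Set
Odd k = ∃[ m ] k ≡ suc (2 ℕ.* m)

ℕtoℚ : ℕ → ℚ
ℕtoℚ k = (+ k) ℚ./ 1

ℤtoℚ : ℤ → ℚ
ℤtoℚ z = z ℚ./ 1

sumℚ : List ℚ → ℚ
sumℚ = foldr ℚ._+_ 0ℚ

Σℚ : ∀ {n} → (Fin n → ℚ) → ℚ
Σℚ {n} f = sumℚ (map f (allFin n))

δ : ∀ {n} → Fin n → Fin n → ℚ
δ a b with a Fin.≟ b
... | yes _ = 1ℚ
... | no  _ = 0ℚ

-- Triangulations of closed surfaces, described combinatorially:
-- vertex set Fin n, a list of triangular faces (with multiplicity).

Face : ℕ → Set
Face n = Fin n × Fin n × Fin n

_∈F_ : ∀ {n} → Fin n → Face n → Set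
v ∈F (a , b , c) = (v ≡ a) ⊎ (v ≡ b) ⊎ (v ≡ c)

inFaceᵇ : ∀ {n} → Fin n → Face n → Bool
inFaceᵇ v (a , b , c) with v Fin.≟ a | v Fin.≟ b | v Fin.≟ c
... | no _ | no _ | no _ = false
... | _    | _    | _    = true

countFaces : ∀ {n} → Fin n → Fin n → List (Face n) → ℕ
countFaces u v [] = 0
countFaces u v (f ∷ fs) with inFaceᵇ u f | inFaceᵇ v f
... | true | true = suc (countFaces u v fs)
... | _    | _    = countFaces u v fs

FAdj : ∀ {n} → List (Face n) → Fin n → Fin n → Set
FAdj fs u v = (u ≢ v) × ∃[ f ] (f ∈ fs × u ∈F f × v ∈F f)

LinkAdj : ∀ {n} → List (Face n) → Fin n → Fin n → Fin n → Set
LinkAdj fs x u w = (u ≢ w) × (u ≢ x) × (w ≢ x) ×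
                   ∃[ f ] (f ∈ fs × x ∈F f × u ∈F f × w ∈F f)

-- A triangulation of a (connected) closed surface: every face is a
-- triangle on three distinct vertices, every vertex lies on a face,
-- every edge lies on exactly two faces, the link of every vertex is
-- connected (hence a single cycle), and the graph is connected.
record Triangulation : Set where
  field
    n        : ℕ
    faces    : List (Face n)
    distinct : All (λ { (a , b , c) → (a ≢ b) × (b ≢ c) × (a ≢ c) }) faces
    covered  : ∀ v → ∃[ f ] (f ∈ faces × v ∈F f)
    edge2    : ∀ u v → FAdj faces u v → countFaces u v faces ≡ 2
    linkConn : ∀ x u w → FAdj faces x u → FAdj faces x w →
               Star (LinkAdj faces x) u w
    connected : ∀ u v → Star (FAdj faces) u v

  Adj : Fin n → Fin n → Set
  Adj = FAdj faces

module GraphNotions {n : ℕ} (Adj : Fin n → Fin n → Set) where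

  NeighbourhoodBipartite : Fin n → Set
  NeighbourhoodBipartite x =
    Σ (Fin n → Bool) λ col →
      ∀ u w → Adj x u → Adj x w → Adj u w → col u ≢ col w

  CycNext : (k : ℕ) → Fin k → Fin k → Set
  CycNext k i j = (suc (toℕ i) ≡ toℕ j) ⊎ ((suc (toℕ i) ≡ k) × (toℕ j ≡ 0))

  record OddCycle : Set where
    field
      len   : ℕ
      len≥3 : 3 ℕ.≤ len
      odd   : Odd len
      vert  : Fin len → Fin n
      inj   : ∀ i j → vert i ≡ vert j → i ≡ j
      edges : ∀ i j → CycNext len i j → Adj (vert i) (vert j)

  Induced : OddCycle → Set
  Induced C = ∀ i j → Adj (vert i) (vert j) → CycNext len i j ⊎ CycNext len j i
    where open OddCycle C

  record InducedOddCycle : Set where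
    field
      cyc     : OddCycle
      induced : Induced cyc
    open OddCycle cyc public

  Vect : Set
  Vect = Fin n → ℚ

  _·_ : Vect → Vect → ℚ
  x · y = Σℚ (λ v → x v ℚ.* y v)

  TSTAB : Vect → Set
  TSTAB x = (∀ v → 0ℚ ℚ.≤ x v)
          × (∀ u v → Adj u v → (x u ℚ.+ x v) ℚ.≤ 1ℚ)
          × (∀ (C : InducedOddCycle) →
               Σℚ (λ i → x (InducedOddCycle.vert C i))
                 ℚ.≤ ℕtoℚ (InducedOddCycle.len C / 2))

  Stable : (Fin n → Bool) → Set
  Stable S = ∀ u v → Adj u v → S u ≡ true → S v ≡ false

  χvec : (Fin n → Bool) → Vect
  χvec S v = if S v then 1ℚ else 0ℚ

  SSP : Vect → Set
  SSP x = Σ (List (Σ (Fin n → Bool) Stable × ℚ)) λ L → ( All (λ p → 0ℚ ℚ.≤ proj₂ p) L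
                 × sumℚ (map proj₂ L) ≡ 1ℚ
                 × (∀ v → x v ≡ sumℚ (map (λ p → proj₂ p ℚ.* χvec (proj₁ (proj₁ p)) v) L)))

  TPerfect : Set
  TPerfect = ∀ x → SSP x ⇔ TSTAB x

  -- the linear system defining TSTAB, as rows  a·x ≤ b
  data Constraint : Set where
    nonneg : Fin n → Constraint
    edge   : (u v : Fin n) → Adj u v → Constraint
    oddcyc : InducedOddCycle → Constraint

  row : Constraint → Vect
  row (nonneg v)   w = ℚ.- δ v w
  row (edge u v _) w = δ u w ℚ.+ δ v w
  row (oddcyc C)   w = Σℚ (λ i → δ (InducedOddCycle.vert C i) w)

  rhs : Constraint → ℚ
  rhs (nonneg v)   = 0ℚ
  rhs (edge u v _) = 1ℚ
  rhs (oddcyc C)   = ℕtoℚ (InducedOddCycle.len C / 2)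

  -- dual solutions: finitely supported nonnegative weightings of rows
  DualSol : Set
  DualSol = List (Constraint × ℚ)

  DualFeasible : (Fin n → ℤ) → DualSol → Set
  DualFeasible w y = All (λ p → 0ℚ ℚ.≤ proj₂ p) y
                   × (∀ v → sumℚ (map (λ p → proj₂ p ℚ.* row (proj₁ p) v) y) ≡ ℤtoℚ (w v))

  dualValue : DualSol → ℚ
  dualValue y = sumℚ (map (λ p → proj₂ p ℚ.* rhs (proj₁ p)) y)

  DualOptimal : (Fin n → ℤ) → DualSol → Set
  DualOptimal w y = DualFeasible w y × (∀ y′ → DualFeasible w y′ → dualValue y ℚ.≤ dualValue y′)

  Integral : DualSol → Set
  Integral y = All (λ p → ∃[ z ] proj₂ p ≡ ℤtoℚ z) y

  -- the system is TDI (the LP is bounded for every objective w)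
  StronglyTPerfect : Set
  StronglyTPerfect = ∀ (w : Fin n → ℤ) → ∃[ y ] (DualOptimal w y × Integral y)

  Colouring : (Fin n → Bool) → ℕ → Set
  Colouring S k = Σ ((v : Fin n) → S v ≡ true → Fin k) λ c →
                    ∀ u v (su : S u ≡ true) (sv : S v ≡ true) → Adj u v → c u su ≢ c v sv

  Clique : (Fin n → Bool) → ℕ → Set
  Clique S k = Σ (Fin k → Fin n) λ f →
                 (∀ i → S (f i) ≡ true) × (∀ i j → f i ≡ f j → i ≡ j)
                 × (∀ i j → i ≢ j → Adj (f i) (f j))

  IsChromaticNumber : (Fin n → Bool) → ℕ → Set
  IsChromaticNumber S k = Colouring S k × (∀ m → Colouring S m → k ℕ.≤ m)

  IsCliqueNumber : (Fin n → Bool) → ℕ → Set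
  IsCliqueNumber S k = Clique S k × (∀ m → Clique S m → m ℕ.≤ k)

  Perfect : Set
  Perfect = ∀ S k → IsChromaticNumber S k → IsCliqueNumber S k

  K4Free : Set
  K4Free = ¬ (Σ (Fin 4 → Fin n) λ f → (∀ (i j : Fin 4) → i ≢ j → Adj (f i) (f j)))

  LooseOddWheel : Set
  LooseOddWheel =
    Σ OddCycle λ C → let open OddCycle C in
    Σ (Fin n) λ v → (∀ i → vert i ≢ v) ×
    Σ (Fin len) λ i → Σ (Fin len) λ j → Σ (Fin len) λ l →
      (toℕ i ℕ.< toℕ j) × (toℕ j ℕ.< toℕ l)
      × Adj v (vert i) × Adj v (vert j) × Adj v (vert l)
      × Odd (toℕ j ∸ toℕ i) × Odd (toℕ l ∸ toℕ j) × Odd ((len ∸ toℕ l) ℕ.+ toℕ i)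

  InducedC7bar : Set
  InducedC7bar = Σ (Fin 7 → Fin n) λ f →
    (∀ i j → f i ≡ f j → i ≡ j)
    × (∀ i j → i ≢ j → Adj (f i) (f j) ⇔ (¬ (CycNext 7 i j ⊎ CycNext 7 j i)))

-- A non-bipartite graph has an odd closed walk, and a shortest one is an
-- induced odd cycle: a repeated vertex or a chord would split it into two
-- shorter closed walks, one of which is odd.  Applied to the neighbourhood of
-- x this gives an odd wheel W: a hub x joined to every vertex of an induced
-- odd cycle C = c₀ … c₂ₖ.  Nothing about surfaces is needed beyond G being a
-- finite simple graph; all four conclusions are properties of odd wheels.
--   * x, c₀, c₁, c₂ form a loose odd wheel.
--   * W has a 4-colouring, and any colouring of W needs 4 colours, since the
--     rim avoids the colour of the hub and an odd cycle is not 2-colourable.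
--     So if G were perfect, W would contain a clique of size 4.
--   * Weight the hub by k and each cᵢ by 1.  A stable set has weight at most
--     k (it contains x, or at most k vertices of C), but the constant point ⅓
--     lies in TSTAB and has weight k + ⅓; so it is not in SSP.
--   * For the same weights, half the row x_hub ≥ 0 plus half of each
--     triangle x cᵢ cᵢ₊₁ is a dual solution of value k + ½, whereas weak
--     duality at the point ⅓ bounds every dual solution below by k + ⅓.  An
--     integral optimum would be an integer strictly between k and k + 1.

{-# OPTIONS --safe #-}
module Submission where

open import Defs
open import Algebra.Bundles using (CommutativeMonoid)
open import Data.Bool using (Bool; true; false; if_then_else_)
open import Data.Bool.Properties using (T-≡)
open import Data.Empty using (⊥; ⊥-elim)
open import Data.Fin as Fin using (Fin; toℕ; fromℕ<)
import Data.Fin.Properties as Fin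
open import Data.Fin.Patterns using (0F; 1F; 2F; 3F)
open import Data.Integer as ℤ using (ℤ; -[1+_])
import Data.Integer.Properties as ℤ
open import Data.List using (List; []; _∷_; map; allFin)
import Data.List.Properties as List
open import Data.List.Membership.Propositional using (find; lose)
open import Data.List.Relation.Unary.All as All using (All; []; _∷_)
open import Data.List.Relation.Unary.All.Properties using (map⁺)
open import Data.List.Relation.Unary.Any using (any?)
open import Data.Nat as ℕ using (ℕ; zero; suc; z≤n; s≤s; parity)
open import Data.Nat.Coprimality using (1-coprimeTo)
import Data.Nat.Coprimality as Coprime
open import Data.Nat.DivMod as ℕ using (_/_)
open import Data.Nat.Induction using (<-wellFounded)
import Data.Nat.Properties as ℕ
open import Data.Nat.Tactic.RingSolver using (solve-∀)
open import Data.Parity.Base as ℙ using (0ℙ; 1ℙ; _⁻¹)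
import Data.Parity.Properties as ℙ
open import Data.Product using (Σ; ∃; ∃₂; _×_; _,_; proj₁; proj₂)
open import Data.Rational as ℚ using (ℚ; mkℚ; 0ℚ; 1ℚ; ½; _+_; _*_; _≤_; _<_; -_)
import Data.Rational.Properties as ℚ
open import Data.Rational.Solver using (module +-*-Solver)
open import Data.Sum using (_⊎_; inj₁; inj₂; [_,_]′)
open import Function using (_∘_)
open import Function.Bundles using (Equivalence)
open import Induction.WellFounded using (Acc; acc)
open import Relation.Binary.Definitions using (tri<; tri≈; tri>)
open import Relation.Binary.PropositionalEquality
open import Relation.Nullary using (¬_; Dec; yes; no)
open import Relation.Nullary.Decidable
  using (_×-dec_; _⊎-dec_; ¬?; map′; isYes; toWitness; fromWitness; from-yes)
open import Relation.Unary using (Decidable)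
open import Algebra.Properties.CommutativeSemigroup
  (CommutativeMonoid.commutativeSemigroup ℚ.+-0-commutativeMonoid) using (interchange)

leastFin : ∀ {m} {P : Fin m → Set} → Decidable P → ∃ P → ∃ λ i → P i × (∀ j → P j → i Fin.≤ j)
leastFin {suc m} P? (i , Pi) with P? Fin.zero
... | yes P0 = Fin.zero , P0 , λ _ _ → z≤n
... | no ¬P0 with i
...   | Fin.zero = ⊥-elim (¬P0 Pi)
...   | Fin.suc i′ with leastFin (P? ∘ Fin.suc) (i′ , Pi)
...     | j , Pj , least = Fin.suc j , Pj , λ where
                               Fin.zero    P0 → ⊥-elim (¬P0 P0)
                               (Fin.suc k) Pk → s≤s (least k Pk)

parity-odd-+ : ∀ s t → parity (s ℕ.+ t) ≡ 1ℙ → parity s ≡ 1ℙ ⊎ parity t ≡ 1ℙ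
parity-odd-+ s t s+t-odd with parity s in s-parity
... | 1ℙ = inj₁ refl
... | 0ℙ = inj₂ (trans (cong (ℙ._+ parity t) (sym s-parity)) (trans (sym (ℙ.+-homo-+ s t)) s+t-odd))

sameParity⇒parity[m+1+n]≡1ℙ : ∀ m n → parity m ≡ parity n → parity (m ℕ.+ suc n) ≡ 1ℙ
sameParity⇒parity[m+1+n]≡1ℙ m n same = begin
  parity (m ℕ.+ suc n)         ≡⟨ ℙ.+-homo-+ m (suc n) ⟩
  parity m ℙ.+ parity (suc n)  ≡⟨ cong₂ ℙ._+_ (sym same) (ℙ.⁻¹-selfInverse (ℙ.suc-homo-⁻¹ n)) ⟨
  parity n ℙ.+ parity n ⁻¹     ≡⟨ ℙ.p+p⁻¹≡1ℙ (parity n) ⟩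
  1ℙ                           ∎
  where open ≡-Reasoning

parity≡1ℙ⇒Odd : ∀ m → parity m ≡ 1ℙ → Odd m
parity≡1ℙ⇒Odd 1             _   = 0 , refl
parity≡1ℙ⇒Odd (suc (suc m)) odd with parity≡1ℙ⇒Odd m odd
... | k , refl = suc k , cong (suc ∘ suc) (sym (ℕ.+-suc k (k ℕ.+ 0)))

Odd-pred₂ : ∀ {m} → Odd (suc (suc m)) → Odd m
Odd-pred₂ (zero  , ())
Odd-pred₂ (suc k , eq) = k , ℕ.suc-injective (trans (ℕ.suc-injective eq) (cong suc (ℕ.+-suc k (k ℕ.+ 0))))

split-<-≤ : ∀ {i j ℓ} → i ℕ.< j → j ℕ.≤ ℓ →
            ∃₂ λ d t → i ℕ.+ (suc d ℕ.+ t) ≡ ℓ × i ℕ.+ suc d ≡ j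
split-<-≤ {i} i<j j≤ℓ with ℕ.m≤n⇒∃[o]m+o≡n i<j | ℕ.m≤n⇒∃[o]m+o≡n j≤ℓ
... | d , 1+i+d≡j | t , j+t≡ℓ =
  d , t , trans (sym (ℕ.+-assoc i (suc d) t)) (trans (cong (ℕ._+ t) i+1+d≡j) j+t≡ℓ) , i+1+d≡j
  where i+1+d≡j = trans (ℕ.+-suc i d) 1+i+d≡j

module Walks {n : ℕ} (E : Fin n → Fin n → Set) (E? : ∀ u v → Dec (E u v))
             (E-sym : ∀ {u v} → E u v → E v u) (E-irrefl : ∀ {u} → ¬ E u u) where
  open GraphNotions E using (CycNext; InducedOddCycle)

  infixr 5 _∷_
  data Walk : Fin n → Fin n → ℕ → Set where
    []  : ∀ {u} → Walk u u 0
    _∷_ : ∀ {u v w ℓ} → E u v → Walk v w ℓ → Walk u w (suc ℓ)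

  -- at p i is the i-th vertex of p, and its last vertex for i beyond the length.
  at : ∀ {u v ℓ} → Walk u v ℓ → ℕ → Fin n
  at {u} _       zero    = u
  at {u} []      (suc _) = u
  at     (_ ∷ p) (suc i) = at p i

  at-end : ∀ {u v ℓ} (p : Walk u v ℓ) → at p ℓ ≡ v
  at-end []      = refl
  at-end (_ ∷ p) = at-end p

  at-step : ∀ {u v ℓ} (p : Walk u v ℓ) {i} → i ℕ.< ℓ → E (at p i) (at p (suc i))
  at-step (e ∷ _) {zero}  _          = e
  at-step (_ ∷ p) {suc i} (s≤s i<ℓ) = at-step p i<ℓ

  infixr 5 _++_
  _++_ : ∀ {u v w a b} → Walk u v a → Walk v w b → Walk u w (a ℕ.+ b)
  []      ++ q = q
  (e ∷ p) ++ q = e ∷ (p ++ q)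

  infixl 5 _∷ʳ_
  _∷ʳ_ : ∀ {u v w ℓ} → Walk u v ℓ → E v w → Walk u w (suc ℓ)
  []      ∷ʳ e = e ∷ []
  (f ∷ p) ∷ʳ e = f ∷ (p ∷ʳ e)

  reverse : ∀ {u v ℓ} → Walk u v ℓ → Walk v u ℓ
  reverse []      = []
  reverse (e ∷ p) = reverse p ∷ʳ E-sym e

  walk? : ∀ ℓ u v → Dec (Walk u v ℓ)
  walk? zero u v with u Fin.≟ v
  ... | yes refl = yes []
  ... | no  u≢v  = no λ { [] → u≢v refl }
  walk? (suc ℓ) u v with Fin.any? (λ w → E? u w ×-dec walk? ℓ w v)
  ... | yes (_ , e , p) = yes (e ∷ p)
  ... | no  none        = no λ { (e ∷ p) → none (_ , e , p) }

  splitAt₃ : ∀ a s {t u v} (p : Walk u v (a ℕ.+ (s ℕ.+ t))) →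
             Walk u (at p a) a × Walk (at p a) (at p (a ℕ.+ s)) s × Walk (at p (a ℕ.+ s)) v t
  splitAt₃ zero    zero    p       = [] , [] , p
  splitAt₃ zero    (suc s) (e ∷ p) with splitAt₃ zero s p
  ... | _ , p₂ , p₃ = [] , e ∷ p₂ , p₃
  splitAt₃ (suc a) s       (e ∷ p) with splitAt₃ a s p
  ... | p₁ , p₂ , p₃ = e ∷ p₁ , p₂ , p₃

  cutLoop : ∀ {u v ℓ} (p : Walk u v ℓ) a s t → a ℕ.+ (s ℕ.+ t) ≡ ℓ → at p a ≡ at p (a ℕ.+ s) →
            Walk (at p a) (at p a) s × Walk u v (a ℕ.+ t)
  cutLoop p a s t refl same with splitAt₃ a s p
  ... | p₁ , p₂ , p₃ = subst (λ w → Walk (at p a) w s) (sym same) p₂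
                     , p₁ ++ subst (λ w → Walk w _ t) (sym same) p₃

  cutChord : ∀ {u v ℓ} (p : Walk u v ℓ) a s t → a ℕ.+ (s ℕ.+ t) ≡ ℓ → E (at p a) (at p (a ℕ.+ s)) →
             Walk (at p a) (at p a) (suc s) × Walk u v (a ℕ.+ suc t)
  cutChord p a s t refl chord with splitAt₃ a s p
  ... | p₁ , p₂ , p₃ = p₂ ∷ʳ E-sym chord , p₁ ++ (chord ∷ p₃)

  ClosedWalk : ℕ → Set
  ClosedWalk ℓ = ∃ λ v → Walk v v ℓ

  OddClosedWalk : ℕ → Set
  OddClosedWalk ℓ = parity ℓ ≡ 1ℙ × ClosedWalk ℓ

  oddClosedWalk? : ∀ ℓ → Dec (OddClosedWalk ℓ)
  oddClosedWalk? ℓ = (parity ℓ ℙ.≟ 1ℙ) ×-dec Fin.any? (λ v → walk? ℓ v v)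

  sameParity⇒OddClosedWalk : ∀ {r u v a b} → Walk r u a → E u v → Walk r v b →
                             parity a ≡ parity b → OddClosedWalk (a ℕ.+ suc b)
  sameParity⇒OddClosedWalk {a = a} {b} p uv q same =
    sameParity⇒parity[m+1+n]≡1ℙ a b same , _ , p ++ (uv ∷ reverse q)

  odd-closedWalk⇒3≤ : ∀ {v ℓ} → Walk v v ℓ → parity ℓ ≡ 1ℙ → 3 ℕ.≤ ℓ
  odd-closedWalk⇒3≤ {ℓ = 1} (e ∷ []) _ = ⊥-elim (E-irrefl e)
  odd-closedWalk⇒3≤ {ℓ = suc (suc (suc _))} _ _ = s≤s (s≤s (s≤s z≤n))

  module ShortestOddClosedWalk {v ℓ} (c : Walk v v ℓ) (c-odd : parity ℓ ≡ 1ℙ)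
                               (shortest : ∀ m → m ℕ.< ℓ → ¬ OddClosedWalk m) where

    -- Loops and chords of c split it into two shorter closed walks of total length ℓ or ℓ + 2.
    no-odd-split : ∀ s t → parity (s ℕ.+ t) ≡ 1ℙ → s ℕ.< ℓ → t ℕ.< ℓ →
                   ClosedWalk s → ClosedWalk t → ⊥
    no-odd-split s t s+t-odd s<ℓ t<ℓ cs ct =
      [ (λ s-odd → shortest s s<ℓ (s-odd , cs)) , (λ t-odd → shortest t t<ℓ (t-odd , ct)) ]′
        (parity-odd-+ s t s+t-odd)

    split-<-< : ∀ {i j} → i ℕ.< j → j ℕ.< ℓ →
                ∃₂ λ d e → i ℕ.+ (suc d ℕ.+ suc e) ≡ ℓ × i ℕ.+ suc d ≡ j
    split-<-< {i} i<j j<ℓ with split-<-≤ i<j (ℕ.<⇒≤ j<ℓ)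
    ... | d , suc e , i+[1+d+t]≡ℓ , i+1+d≡j = d , e , i+[1+d+t]≡ℓ , i+1+d≡j
    ... | d , zero  , i+[1+d+0]≡ℓ , i+1+d≡j =
      ⊥-elim (ℕ.<-irrefl j≡ℓ j<ℓ)
      where
      j≡ℓ = trans (sym i+1+d≡j) (trans (cong (i ℕ.+_) (sym (ℕ.+-identityʳ (suc d)))) i+[1+d+0]≡ℓ)

    loop-free : ∀ {i j} → i ℕ.< j → j ℕ.< ℓ → at c i ≢ at c j
    loop-free {i} i<j j<ℓ same with split-<-< i<j j<ℓ
    ... | d , e , ℓ≡ , i+1+d≡j with cutLoop c i (suc d) (suc e) ℓ≡ (trans same (cong (at c) (sym i+1+d≡j)))
    ...   | loop , rest =
      no-odd-split (suc d) (i ℕ.+ suc e) (subst (λ m → parity m ≡ 1ℙ) (sym sum) c-odd)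
        (subst (suc d ℕ.<_) sum (ℕ.m<m+n (suc d) (subst (0 ℕ.<_) (sym (ℕ.+-suc i e)) (s≤s z≤n))))
        (subst (i ℕ.+ suc e ℕ.<_) sum (ℕ.m<n+m (i ℕ.+ suc e) {suc d} (s≤s z≤n)))
        (_ , loop) (_ , rest)
      where
      sum : suc d ℕ.+ (i ℕ.+ suc e) ≡ ℓ
      sum = trans (rearrange i d e) ℓ≡
        where rearrange : ∀ i d e → suc d ℕ.+ (i ℕ.+ suc e) ≡ i ℕ.+ (suc d ℕ.+ suc e)
              rearrange = solve-∀

    long-chord-free : ∀ i d e k → i ℕ.+ e ≡ suc k → i ℕ.+ (suc (suc d) ℕ.+ suc e) ≡ ℓ →
                      ¬ E (at c i) (at c (i ℕ.+ suc (suc d)))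
    long-chord-free i d e k i+e≡1+k ℓ≡ chord with cutChord c i (suc (suc d)) (suc e) ℓ≡ chord
    ... | loop , rest =
      no-odd-split (3 ℕ.+ d) (i ℕ.+ suc (suc e)) (subst (λ m → parity m ≡ 1ℙ) (sym sum) c-odd)
        (subst (3 ℕ.+ d ℕ.<_) (trans (sym short-side) ℓ≡) (ℕ.m<m+n (3 ℕ.+ d) (s≤s z≤n)))
        (subst (i ℕ.+ suc (suc e) ℕ.<_) (trans (long-side i d e) ℓ≡) (ℕ.m<m+n (i ℕ.+ suc (suc e)) (s≤s z≤n)))
        (_ , loop) (_ , rest)
      where
      sum : 3 ℕ.+ d ℕ.+ (i ℕ.+ suc (suc e)) ≡ 2 ℕ.+ ℓ
      sum = trans (total i d e) (cong (2 ℕ.+_) ℓ≡)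
        where total : ∀ i d e → 3 ℕ.+ d ℕ.+ (i ℕ.+ suc (suc e)) ≡ 2 ℕ.+ (i ℕ.+ (suc (suc d) ℕ.+ suc e))
              total = solve-∀
      short-side : i ℕ.+ (suc (suc d) ℕ.+ suc e) ≡ 3 ℕ.+ d ℕ.+ suc k
      short-side = trans (shuffle i d e) (cong (3 ℕ.+ d ℕ.+_) i+e≡1+k)
        where shuffle : ∀ i d e → i ℕ.+ (suc (suc d) ℕ.+ suc e) ≡ 3 ℕ.+ d ℕ.+ (i ℕ.+ e)
              shuffle = solve-∀
      long-side : ∀ i d e → i ℕ.+ suc (suc e) ℕ.+ suc d ≡ i ℕ.+ (suc (suc d) ℕ.+ suc e)
      long-side = solve-∀

    chord-free : ∀ {i j} → i ℕ.< j → j ℕ.< ℓ → E (at c i) (at c j) → suc i ≡ j ⊎ (i ≡ 0 × suc j ≡ ℓ)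
    chord-free {i} i<j j<ℓ chord with split-<-< i<j j<ℓ
    ... | zero    , e    , _  , i+1≡j = inj₁ (trans (ℕ.+-comm 1 i) i+1≡j)
    ... | suc d   , zero , ℓ≡ , i+2+d≡j with i
    ...   | zero   = inj₂ (refl , trans (cong suc (sym i+2+d≡j)) (trans (ℕ.+-comm 1 (2 ℕ.+ d)) ℓ≡))
    ...   | suc i′ = ⊥-elim (long-chord-free (suc i′) d 0 i′ (ℕ.+-identityʳ (suc i′)) ℓ≡
                               (subst (E _ ∘ at c) (sym i+2+d≡j) chord))
    chord-free {i} i<j j<ℓ chord | suc d , suc e , ℓ≡ , i+2+d≡j =
      ⊥-elim (long-chord-free i d (suc e) (i ℕ.+ e) (ℕ.+-suc i e) ℓ≡ (subst (E _ ∘ at c) (sym i+2+d≡j) chord))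

    vert : Fin ℓ → Fin n
    vert i = at c (toℕ i)

    inducedOddCycle : InducedOddCycle
    inducedOddCycle = record
      { cyc     = record { len = ℓ ; len≥3 = odd-closedWalk⇒3≤ c c-odd ; odd = parity≡1ℙ⇒Odd ℓ c-odd
                         ; vert = vert ; inj = vert-injective ; edges = edges }
      ; induced = induced
      }
      where
      edges : ∀ i j → CycNext ℓ i j → E (vert i) (vert j)
      edges i j (inj₁ i+1≡j)         = subst (E (vert i) ∘ at c) i+1≡j (at-step c (Fin.toℕ<n i))
      edges i j (inj₂ (i+1≡ℓ , j≡0)) = subst (E (vert i)) wrap (at-step c (Fin.toℕ<n i))
        where
        wrap : at c (suc (toℕ i)) ≡ vert j
        wrap = trans (cong (at c) i+1≡ℓ) (trans (at-end c) (cong (at c) (sym j≡0)))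
      vert-injective : ∀ i j → vert i ≡ vert j → i ≡ j
      vert-injective i j same with Fin.<-cmp i j
      ... | tri< i<j _ _ = ⊥-elim (loop-free i<j (Fin.toℕ<n j) same)
      ... | tri≈ _ i≡j _ = i≡j
      ... | tri> _ _ j<i = ⊥-elim (loop-free j<i (Fin.toℕ<n i) (sym same))
      induced : ∀ i j → E (vert i) (vert j) → CycNext ℓ i j ⊎ CycNext ℓ j i
      induced i j ij with Fin.<-cmp i j
      ... | tri< i<j _ _ = [ (λ i+1≡j → inj₁ (inj₁ i+1≡j)) , (λ (i≡0 , j+1≡ℓ) → inj₂ (inj₂ (j+1≡ℓ , i≡0))) ]′
                             (chord-free i<j (Fin.toℕ<n j) ij)
      ... | tri≈ _ refl _ = ⊥-elim (E-irrefl ij)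
      ... | tri> _ _ j<i = [ (λ j+1≡i → inj₂ (inj₁ j+1≡i)) , (λ (j≡0 , i+1≡ℓ) → inj₁ (inj₂ (i+1≡ℓ , j≡0))) ]′
                             (chord-free j<i (Fin.toℕ<n i) (E-sym ij))

  Bipartite : Set
  Bipartite = Σ (Fin n → Bool) λ colour → ∀ u v → E u v → colour u ≢ colour v

  module Bipartition (no-short-odd : ∀ ℓ → ℓ ℕ.< n ℕ.+ n → ¬ OddClosedWalk ℓ) where

    Reach : Fin n → Fin n → Set
    Reach r v = ∃ λ (ℓ : Fin n) → Walk r v (toℕ ℓ)

    EvenReach : Fin n → Fin n → Set
    EvenReach r v = ∃ λ (ℓ : Fin n) → parity (toℕ ℓ) ≡ 0ℙ × Walk r v (toℕ ℓ)

    reach? : ∀ r v → Dec (Reach r v)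
    reach? r v = Fin.any? (λ ℓ → walk? (toℕ ℓ) r v)

    evenReach? : ∀ r v → Dec (EvenReach r v)
    evenReach? r v = Fin.any? (λ ℓ → (parity (toℕ ℓ) ℙ.≟ 0ℙ) ×-dec walk? (toℕ ℓ) r v)

    -- A walk of length ≥ n repeats a vertex among its first n + 1 positions.
    shorten : ∀ {u v ℓ} → Walk u v ℓ → Reach u v
    shorten p = go p (<-wellFounded _)
      where
      go : ∀ {u v ℓ} → Walk u v ℓ → Acc ℕ._<_ ℓ → Reach u v
      go {ℓ = ℓ} p (acc shorter) with ℓ ℕ.<? n
      ... | yes ℓ<n = fromℕ< ℓ<n , subst (Walk _ _) (sym (Fin.toℕ-fromℕ< ℓ<n)) p
      ... | no  ℓ≮n with Fin.pigeonhole (ℕ.n<1+n n) (λ (i : Fin (suc n)) → at p (toℕ i))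
      ...   | i , j , i<j , same with split-<-≤ i<j (ℕ.≤-trans (ℕ.s≤s⁻¹ (Fin.toℕ<n j)) (ℕ.≮⇒≥ ℓ≮n))
      ...     | d , t , ℓ≡ , i+1+d≡j with cutLoop p (toℕ i) (suc d) t ℓ≡ (trans same (cong (at p) (sym i+1+d≡j)))
      ...       | _ , rest = go rest (shorter (subst (toℕ i ℕ.+ t ℕ.<_) ℓ≡ (ℕ.+-monoʳ-< (toℕ i) (ℕ.m<n+m t (s≤s z≤n)))))

    root-spec : ∀ v → ∃ λ r → Reach r v × (∀ r′ → Reach r′ v → r Fin.≤ r′)
    root-spec v = leastFin (λ r → reach? r v) (v , fromℕ< 0<n , subst (Walk v v) (sym (Fin.toℕ-fromℕ< 0<n)) [])
      where 0<n = ℕ.≤-<-trans z≤n (Fin.toℕ<n v)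

    root : Fin n → Fin n
    root v = proj₁ (root-spec v)

    root-reaches : ∀ v → Reach (root v) v
    root-reaches v = proj₁ (proj₂ (root-spec v))

    root-least : ∀ {r v} → Reach r v → root v Fin.≤ r
    root-least {r} {v} = proj₂ (proj₂ (root-spec v)) r

    root-edge : ∀ {u v} → E u v → root u ≡ root v
    root-edge {u} {v} uv = Fin.≤-antisym (root-least (extend (root-reaches v) (E-sym uv)))
                                         (root-least (extend (root-reaches u) uv))
      where
      extend : ∀ {r w x} → Reach r w → E w x → Reach r x
      extend (_ , p) e = shorten (p ∷ʳ e)

    -- Colour v by whether the least vertex of its component reaches it by an even
    -- walk.  Equal colours across an edge would close an odd walk shorter than 2n.
    colour : Fin n → Bool
    colour v = isYes (evenReach? (root v) v)

    colour-proper : ∀ u v → E u v → colour u ≢ colour v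
    colour-proper u v uv = proper (root-edge uv) (root-reaches u) (root-reaches v)
                                  (evenReach? (root u) u) (evenReach? (root v) v)
      where
      short-odd : ∀ {r} (a b : Fin n) → Walk r u (toℕ a) → Walk r v (toℕ b) → parity (toℕ a) ≡ parity (toℕ b) → ⊥
      short-odd a b p q same =
        no-short-odd _ (ℕ.+-mono-≤ (Fin.toℕ<n a) (Fin.toℕ<n b)) (sameParity⇒OddClosedWalk p uv q same)
      odd : ∀ {r w} → ¬ EvenReach r w → (a : Fin n) → Walk r w (toℕ a) → parity (toℕ a) ≡ 1ℙ
      odd ¬even a p with parity (toℕ a) in a-parity
      ... | 1ℙ = refl
      ... | 0ℙ = ⊥-elim (¬even (a , a-parity , p))
      proper : ∀ {r₁ r₂} → r₁ ≡ r₂ → Reach r₁ u → Reach r₂ v →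
               (du : Dec (EvenReach r₁ u)) (dv : Dec (EvenReach r₂ v)) → isYes du ≢ isYes dv
      proper refl _ _ (yes (a , a-even , p)) (yes (b , b-even , q)) _ = short-odd a b p q (trans a-even (sym b-even))
      proper refl (a , p) (b , q) (no ¬even-u) (no ¬even-v) _ =
        short-odd a b p q (trans (odd ¬even-u a p) (sym (odd ¬even-v b q)))
      proper refl _ _ (yes _) (no _) ()
      proper refl _ _ (no _) (yes _) ()

    bipartite : Bipartite
    bipartite = colour , colour-proper

  nonBipartite⇒InducedOddCycle : ¬ Bipartite → InducedOddCycle
  nonBipartite⇒InducedOddCycle not-bipartite with Fin.any? (λ (ℓ : Fin (n ℕ.+ n)) → oddClosedWalk? (toℕ ℓ))
  ... | no none = ⊥-elim (not-bipartite (Bipartition.bipartite λ ℓ ℓ<2n odd-closed →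
                    none (fromℕ< ℓ<2n , subst OddClosedWalk (sym (Fin.toℕ-fromℕ< ℓ<2n)) odd-closed)))
  ... | yes found with leastFin (oddClosedWalk? ∘ toℕ) found
  ...   | ℓ , (ℓ-odd , _ , c) , least = ShortestOddClosedWalk.inducedOddCycle c ℓ-odd shortest
    where
    shortest : ∀ m → m ℕ.< toℕ ℓ → ¬ OddClosedWalk m
    shortest m m<ℓ odd-closed = ℕ.<⇒≱ m<ℓ (subst (toℕ ℓ ℕ.≤_) (Fin.toℕ-fromℕ< m<2n)
                                  (least (fromℕ< m<2n) (subst OddClosedWalk (sym (Fin.toℕ-fromℕ< m<2n)) odd-closed)))
      where m<2n = ℕ.<-trans m<ℓ (Fin.toℕ<n ℓ)

-- In this normal form, + and * of ℚ on integers compute to those of ℤ.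
ℤtoℚ≡mkℚ : ∀ z → ℤtoℚ z ≡ mkℚ z 0 (Coprime.sym (1-coprimeTo ℤ.∣ z ∣))
ℤtoℚ≡mkℚ (ℤ.+ m)    = ℚ.normalize-coprime (Coprime.sym (1-coprimeTo m))
ℤtoℚ≡mkℚ -[1+ m ] = cong ℚ.-_ (ℚ.normalize-coprime (Coprime.sym (1-coprimeTo (suc m))))

ℤtoℚ-+ : ∀ a b → ℤtoℚ (a ℤ.+ b) ≡ ℤtoℚ a + ℤtoℚ b
ℤtoℚ-+ a b rewrite ℤtoℚ≡mkℚ a | ℤtoℚ≡mkℚ b =
  cong ℤtoℚ (sym (cong₂ ℤ._+_ (ℤ.*-identityʳ a) (ℤ.*-identityʳ b)))

ℤtoℚ-* : ∀ a b → ℤtoℚ (a ℤ.* b) ≡ ℤtoℚ a * ℤtoℚ b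
ℤtoℚ-* a b rewrite ℤtoℚ≡mkℚ a | ℤtoℚ≡mkℚ b = refl

ℤtoℚ-mono-≤ : ∀ {a b} → a ℤ.≤ b → ℤtoℚ a ≤ ℤtoℚ b
ℤtoℚ-mono-≤ {a} {b} a≤b rewrite ℤtoℚ≡mkℚ a | ℤtoℚ≡mkℚ b =
  ℚ.*≤* (subst₂ ℤ._≤_ (sym (ℤ.*-identityʳ a)) (sym (ℤ.*-identityʳ b)) a≤b)

ℕtoℚ-+ : ∀ m n → ℕtoℚ (m ℕ.+ n) ≡ ℕtoℚ m + ℕtoℚ n
ℕtoℚ-+ m n = trans (cong ℤtoℚ (ℤ.pos-+ m n)) (ℤtoℚ-+ (ℤ.+ m) (ℤ.+ n))

ℕtoℚ-* : ∀ m n → ℕtoℚ (m ℕ.* n) ≡ ℕtoℚ m * ℕtoℚ n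
ℕtoℚ-* m n = trans (cong ℤtoℚ (ℤ.pos-* m n)) (ℤtoℚ-* (ℤ.+ m) (ℤ.+ n))

ℕtoℚ-mono-≤ : ∀ {m n} → m ℕ.≤ n → ℕtoℚ m ≤ ℕtoℚ n
ℕtoℚ-mono-≤ m≤n = ℤtoℚ-mono-≤ (ℤ.+≤+ m≤n)

IsInteger : ℚ → Set
IsInteger p = ∃ λ z → p ≡ ℤtoℚ z

IsInteger-+ : ∀ {p q} → IsInteger p → IsInteger q → IsInteger (p + q)
IsInteger-+ (a , refl) (b , refl) = a ℤ.+ b , sym (ℤtoℚ-+ a b)

IsInteger-* : ∀ {p q} → IsInteger p → IsInteger q → IsInteger (p * q)
IsInteger-* (a , refl) (b , refl) = a ℤ.* b , sym (ℤtoℚ-* a b)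

sumℚ-IsInteger : ∀ {A : Set} {f : A → ℚ} xs → All (IsInteger ∘ f) xs → IsInteger (sumℚ (map f xs))
sumℚ-IsInteger []       []       = ℤ.0ℤ , refl
sumℚ-IsInteger (a ∷ xs) (fa ∷ h) = IsInteger-+ fa (sumℚ-IsInteger xs h)

IsInteger-<1+⇒≤ : ∀ {p q} → IsInteger p → IsInteger q → p < 1ℚ + q → p ≤ q
IsInteger-<1+⇒≤ {p} {q} (a , refl) (b , refl) p<1+q with a ℤ.≤? b
... | yes a≤b = ℤtoℚ-mono-≤ a≤b
... | no  a≰b = ⊥-elim (ℚ.<-irrefl refl (ℚ.<-≤-trans p<1+q 1+q≤p))
  where
  1+q≤p : 1ℚ + q ≤ p
  1+q≤p = begin
    1ℚ + ℤtoℚ b        ≡⟨ ℤtoℚ-+ ℤ.1ℤ b ⟨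
    ℤtoℚ (ℤ.suc b)     ≤⟨ ℤtoℚ-mono-≤ (ℤ.i<j⇒suc[i]≤j (ℤ.≰⇒> a≰b)) ⟩
    ℤtoℚ a             ∎
    where open ℚ.≤-Reasoning

p<1+p : ∀ p → p < 1ℚ + p
p<1+p p = begin-strict
  p        ≡⟨ ℚ.+-identityˡ p ⟨
  0ℚ + p   <⟨ ℚ.+-monoˡ-< p (from-yes (0ℚ ℚ.<? 1ℚ)) ⟩
  1ℚ + p   ∎
  where open ℚ.≤-Reasoning

p+p<q+q⇒p<q : ∀ {p q} → p + p < q + q → p < q
p+p<q+q⇒p<q {p} {q} p+p<q+q with p ℚ.<? q
... | yes p<q = p<q
... | no  p≮q = ⊥-elim (ℚ.<-irrefl refl (ℚ.<-≤-trans p+p<q+q (ℚ.+-mono-≤ q≤p q≤p)))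
  where q≤p = ℚ.≮⇒≥ p≮q

⅓ : ℚ
⅓ = ℤ.+ 1 ℚ./ 3

m≤[m/2]*3 : ∀ m → 2 ℕ.≤ m → m ℕ.≤ (m / 2) ℕ.* 3
m≤[m/2]*3 m m≥2 = begin
  m                      ≡⟨ ℕ.m≡m%n+[m/n]*n m 2 ⟩
  m ℕ.% 2 ℕ.+ q ℕ.* 2    ≤⟨ ℕ.+-monoˡ-≤ (q ℕ.* 2) (ℕ.≤-trans (ℕ.s≤s⁻¹ (ℕ.m%n<n m 2)) (ℕ.m≥n⇒m/n>0 m≥2)) ⟩
  q ℕ.+ q ℕ.* 2          ≡⟨ ℕ.*-suc q 2 ⟨
  q ℕ.* 3                ∎
  where
  open ℕ.≤-Reasoning
  q = m / 2

third≤half : ∀ m → 2 ℕ.≤ m → ℕtoℚ m * ⅓ ≤ ℕtoℚ (m / 2)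
third≤half m m≥2 = begin
  ℕtoℚ m * ⅓                     ≤⟨ ℚ.*-monoʳ-≤-nonNeg ⅓ (ℕtoℚ-mono-≤ (m≤[m/2]*3 m m≥2)) ⟩
  ℕtoℚ ((m / 2) ℕ.* 3) * ⅓       ≡⟨ cong (_* ⅓) (ℕtoℚ-* (m / 2) 3) ⟩
  ℕtoℚ (m / 2) * ℕtoℚ 3 * ⅓      ≡⟨ ℚ.*-assoc (ℕtoℚ (m / 2)) (ℕtoℚ 3) ⅓ ⟩
  ℕtoℚ (m / 2) * 1ℚ              ≡⟨ ℚ.*-identityʳ _ ⟩
  ℕtoℚ (m / 2)                   ∎
  where open ℚ.≤-Reasoning

module _ {A : Set} where

  sumℚ-map-cong : ∀ {f g : A → ℚ} xs → (∀ a → f a ≡ g a) → sumℚ (map f xs) ≡ sumℚ (map g xs)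
  sumℚ-map-cong []       f≗g = refl
  sumℚ-map-cong (a ∷ xs) f≗g = cong₂ _+_ (f≗g a) (sumℚ-map-cong xs f≗g)

  sumℚ-map-0 : ∀ xs → sumℚ (map (λ (_ : A) → 0ℚ) xs) ≡ 0ℚ
  sumℚ-map-0 []       = refl
  sumℚ-map-0 (a ∷ xs) = trans (ℚ.+-identityˡ _) (sumℚ-map-0 xs)

  sumℚ-map-+ : ∀ (f g : A → ℚ) xs →
               sumℚ (map (λ a → f a + g a) xs) ≡ sumℚ (map f xs) + sumℚ (map g xs)
  sumℚ-map-+ f g []       = refl
  sumℚ-map-+ f g (a ∷ xs) =
    trans (cong ((f a + g a) +_) (sumℚ-map-+ f g xs)) (interchange (f a) (g a) _ _)

  sumℚ-map-*ˡ : ∀ c (f : A → ℚ) xs → sumℚ (map (λ a → c * f a) xs) ≡ c * sumℚ (map f xs)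
  sumℚ-map-*ˡ c f []       = sym (ℚ.*-zeroʳ c)
  sumℚ-map-*ˡ c f (a ∷ xs) =
    trans (cong (c * f a +_) (sumℚ-map-*ˡ c f xs)) (sym (ℚ.*-distribˡ-+ c (f a) _))

  sumℚ-map-*ʳ : ∀ c (f : A → ℚ) xs → sumℚ (map (λ a → f a * c) xs) ≡ sumℚ (map f xs) * c
  sumℚ-map-*ʳ c f xs = begin
    sumℚ (map (λ a → f a * c) xs)  ≡⟨ sumℚ-map-cong xs (λ a → ℚ.*-comm (f a) c) ⟩
    sumℚ (map (λ a → c * f a) xs)  ≡⟨ sumℚ-map-*ˡ c f xs ⟩
    c * sumℚ (map f xs)            ≡⟨ ℚ.*-comm c _ ⟩
    sumℚ (map f xs) * c            ∎
    where open ≡-Reasoning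

  sumℚ-map-mono-≤ : ∀ {f g : A → ℚ} xs → All (λ a → f a ≤ g a) xs →
                    sumℚ (map f xs) ≤ sumℚ (map g xs)
  sumℚ-map-mono-≤ []       []         = ℚ.≤-refl
  sumℚ-map-mono-≤ (a ∷ xs) (fa≤ga ∷ h) = ℚ.+-mono-≤ fa≤ga (sumℚ-map-mono-≤ xs h)

  sumℚ-weighted-mono-≤ : ∀ (c : A → ℚ) {f g : A → ℚ} xs → All (λ a → 0ℚ ≤ c a) xs →
                         (∀ a → f a ≤ g a) →
                         sumℚ (map (λ a → c a * f a) xs) ≤ sumℚ (map (λ a → c a * g a) xs)
  sumℚ-weighted-mono-≤ c xs c≥0 f≤g = sumℚ-map-mono-≤ xs (All.map scale c≥0)
    where
    scale : ∀ {a} → 0ℚ ≤ c a → c a * _ ≤ c a * _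
    scale {a} 0≤ca = ℚ.*-monoˡ-≤-nonNeg (c a) {{ℚ.nonNegative 0≤ca}} (f≤g a)

sumℚ-map-swap : ∀ {A B : Set} (h : A → B → ℚ) xs ys →
                sumℚ (map (λ a → sumℚ (map (h a) ys)) xs) ≡
                sumℚ (map (λ b → sumℚ (map (λ a → h a b) xs)) ys)
sumℚ-map-swap h []       ys = sym (sumℚ-map-0 ys)
sumℚ-map-swap h (a ∷ xs) ys =
  trans (cong (sumℚ (map (h a) ys) +_) (sumℚ-map-swap h xs ys))
        (sym (sumℚ-map-+ (h a) (λ b → sumℚ (map (λ a → h a b) xs)) ys))

Σℚ-suc : ∀ {n} (f : Fin (suc n) → ℚ) → Σℚ f ≡ f Fin.zero + Σℚ (f ∘ Fin.suc)
Σℚ-suc f = cong (λ fs → f Fin.zero + sumℚ fs)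
  (trans (List.map-tabulate Fin.suc f) (sym (List.map-tabulate (λ i → i) (f ∘ Fin.suc))))

Σℚ-cong : ∀ {n} {f g : Fin n → ℚ} → (∀ i → f i ≡ g i) → Σℚ f ≡ Σℚ g
Σℚ-cong {n} = sumℚ-map-cong (allFin n)

Σℚ-const : ∀ n c → Σℚ {n} (λ _ → c) ≡ ℕtoℚ n * c
Σℚ-const zero    c = sym (ℚ.*-zeroˡ c)
Σℚ-const (suc n) c = begin
  Σℚ {suc n} (λ _ → c)   ≡⟨ Σℚ-suc {n} (λ _ → c) ⟩
  c + Σℚ {n} (λ _ → c)   ≡⟨ cong (c +_) (Σℚ-const n c) ⟩
  c + ℕtoℚ n * c         ≡⟨ cong (_+ ℕtoℚ n * c) (ℚ.*-identityˡ c) ⟨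
  1ℚ * c + ℕtoℚ n * c    ≡⟨ ℚ.*-distribʳ-+ c 1ℚ (ℕtoℚ n) ⟨
  (1ℚ + ℕtoℚ n) * c      ≡⟨ cong (_* c) (ℕtoℚ-+ 1 n) ⟨
  ℕtoℚ (suc n) * c       ∎
  where open ≡-Reasoning

Σℚ-snoc : ∀ m (f : Fin (suc m) → ℚ) → Σℚ f ≡ Σℚ (f ∘ Fin.inject₁) + f (Fin.fromℕ m)
Σℚ-snoc zero    f = trans (ℚ.+-identityʳ (f Fin.zero)) (sym (ℚ.+-identityˡ (f Fin.zero)))
Σℚ-snoc (suc m) f = begin
  Σℚ f
    ≡⟨ Σℚ-suc f ⟩
  f Fin.zero + Σℚ (f ∘ Fin.suc)
    ≡⟨ cong (f Fin.zero +_) (Σℚ-snoc m (f ∘ Fin.suc)) ⟩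
  f Fin.zero + (Σℚ (f ∘ Fin.suc ∘ Fin.inject₁) + f last)
    ≡⟨ ℚ.+-assoc (f Fin.zero) _ _ ⟨
  (f Fin.zero + Σℚ (f ∘ Fin.inject₁ ∘ Fin.suc)) + f last
    ≡⟨ cong (_+ f last) (Σℚ-suc (f ∘ Fin.inject₁)) ⟨
  Σℚ (f ∘ Fin.inject₁) + f last ∎
  where
  open ≡-Reasoning
  last = Fin.fromℕ (suc m)

δ-IsInteger : ∀ {n} (a b : Fin n) → IsInteger (δ a b)
δ-IsInteger a b with a Fin.≟ b
... | yes _ = ℤ.1ℤ , refl
... | no  _ = ℤ.0ℤ , refl

δ-suc : ∀ {n} (a b : Fin n) → δ (Fin.suc a) (Fin.suc b) ≡ δ a b
δ-suc a b with a Fin.≟ b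
... | yes _ = refl
... | no  _ = refl

Σℚ-δ : ∀ {n} (a : Fin n) (f : Fin n → ℚ) → Σℚ (λ v → δ a v * f v) ≡ f a
Σℚ-δ {suc n} Fin.zero f = begin
  Σℚ (λ v → δ Fin.zero v * f v)                    ≡⟨ Σℚ-suc (λ v → δ Fin.zero v * f v) ⟩
  1ℚ * f Fin.zero + Σℚ (λ v → 0ℚ * f (Fin.suc v))  ≡⟨ cong₂ _+_ (ℚ.*-identityˡ (f Fin.zero)) (Σℚ-cong (λ v → ℚ.*-zeroˡ (f (Fin.suc v)))) ⟩
  f Fin.zero + Σℚ {n} (λ _ → 0ℚ)                   ≡⟨ cong (f Fin.zero +_) (sumℚ-map-0 (allFin n)) ⟩
  f Fin.zero + 0ℚ                                  ≡⟨ ℚ.+-identityʳ _ ⟩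
  f Fin.zero                                       ∎
  where open ≡-Reasoning
Σℚ-δ {suc n} (Fin.suc a) f = begin
  Σℚ (λ v → δ (Fin.suc a) v * f v)
    ≡⟨ Σℚ-suc (λ v → δ (Fin.suc a) v * f v) ⟩
  0ℚ * f Fin.zero + Σℚ (λ v → δ (Fin.suc a) (Fin.suc v) * f (Fin.suc v))
    ≡⟨ cong₂ _+_ (ℚ.*-zeroˡ (f Fin.zero)) (Σℚ-cong (λ v → cong (_* f (Fin.suc v)) (δ-suc a v))) ⟩
  0ℚ + Σℚ (λ v → δ a v * f (Fin.suc v))
    ≡⟨ ℚ.+-identityˡ (Σℚ (λ v → δ a v * f (Fin.suc v))) ⟩
  Σℚ (λ v → δ a v * f (Fin.suc v))
    ≡⟨ Σℚ-δ a (f ∘ Fin.suc) ⟩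
  f (Fin.suc a) ∎
  where open ≡-Reasoning

next : ∀ {m} → Fin m → Fin m
next {suc m} i with suc (toℕ i) ℕ.<? suc m
... | yes i+1<m = fromℕ< i+1<m
... | no  _     = Fin.zero

Fin2-≢-≢⇒≡ : ∀ {a b c : Fin 2} → a ≢ b → b ≢ c → a ≡ c
Fin2-≢-≢⇒≡ {0F} {0F}      a≢b _   = ⊥-elim (a≢b refl)
Fin2-≢-≢⇒≡ {1F} {1F}      a≢b _   = ⊥-elim (a≢b refl)
Fin2-≢-≢⇒≡ {0F} {1F} {0F} _   _   = refl
Fin2-≢-≢⇒≡ {1F} {0F} {1F} _   _   = refl
Fin2-≢-≢⇒≡ {0F} {1F} {1F} _   b≢c = ⊥-elim (b≢c refl)
Fin2-≢-≢⇒≡ {1F} {0F} {0F} _   b≢c = ⊥-elim (b≢c refl)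

alternating : ℕ → Fin 3
alternating zero          = 0F
alternating (suc zero)    = 1F
alternating (suc (suc t)) = alternating t

alternating-suc : ∀ t → alternating t ≢ alternating (suc t)
alternating-suc zero          = λ ()
alternating-suc (suc zero)    = λ ()
alternating-suc (suc (suc t)) = alternating-suc t

alternating≢2 : ∀ t → alternating t ≢ 2F
alternating≢2 zero          = λ ()
alternating≢2 (suc zero)    = λ ()
alternating≢2 (suc (suc t)) = alternating≢2 t

cycleColour : ℕ → Fin 3
cycleColour zero    = 2F
cycleColour (suc t) = alternating (suc t)

threeOddGaps : ∀ {m} → 3 ℕ.≤ m → Odd m →
  Σ (Fin m) λ i → Σ (Fin m) λ j → Σ (Fin m) λ l →
    (toℕ i ℕ.< toℕ j) × (toℕ j ℕ.< toℕ l)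
    × Odd (toℕ j ℕ.∸ toℕ i) × Odd (toℕ l ℕ.∸ toℕ j) × Odd ((m ℕ.∸ toℕ l) ℕ.+ toℕ i)
threeOddGaps {1} (s≤s ()) _
threeOddGaps {2} (s≤s (s≤s ())) _
threeOddGaps {suc (suc (suc m))} _ m+3-odd =
  0F , 1F , 2F , s≤s z≤n , s≤s (s≤s z≤n) , (0 , refl) , (0 , refl) ,
  subst Odd (sym (ℕ.+-identityʳ (suc m))) (Odd-pred₂ m+3-odd)

module CycleNotions {n : ℕ} (Adj : Fin n → Fin n → Set) where
  open GraphNotions Adj

  CycNext-next : ∀ {m} (i : Fin m) → CycNext m i (next i)
  CycNext-next {suc m} i with suc (toℕ i) ℕ.<? suc m
  ... | yes i+1<m = inj₁ (sym (Fin.toℕ-fromℕ< i+1<m))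
  ... | no  i+1≮m = inj₂ (ℕ.≤-antisym (Fin.toℕ<n i) (ℕ.≮⇒≥ i+1≮m) , refl)

  CycNext-functional : ∀ {m} {i j j′ : Fin m} → CycNext m i j → CycNext m i j′ → j ≡ j′
  CycNext-functional (inj₁ i+1≡j) (inj₁ i+1≡j′) = Fin.toℕ-injective (trans (sym i+1≡j) i+1≡j′)
  CycNext-functional (inj₂ (_ , j≡0)) (inj₂ (_ , j′≡0)) = Fin.toℕ-injective (trans j≡0 (sym j′≡0))
  CycNext-functional {j = j} (inj₁ i+1≡j) (inj₂ (i+1≡m , _)) =
    ⊥-elim (ℕ.<-irrefl (trans (sym i+1≡j) i+1≡m) (Fin.toℕ<n j))
  CycNext-functional {j′ = j′} (inj₂ (i+1≡m , _)) (inj₁ i+1≡j′) =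
    ⊥-elim (ℕ.<-irrefl (trans (sym i+1≡j′) i+1≡m) (Fin.toℕ<n j′))

  CycNext⇒≡next : ∀ {m} {i j : Fin m} → CycNext m i j → j ≡ next i
  CycNext⇒≡next {i = i} i→j = CycNext-functional i→j (CycNext-next i)

  Σℚ-next : ∀ {m} (f : Fin m → ℚ) → Σℚ (f ∘ next) ≡ Σℚ f
  Σℚ-next {zero}  f = refl
  Σℚ-next {suc m} f = begin
    Σℚ (f ∘ next)
      ≡⟨ Σℚ-snoc m (f ∘ next) ⟩
    Σℚ (f ∘ next ∘ Fin.inject₁) + f (next (Fin.fromℕ m))
      ≡⟨ cong₂ _+_ (Σℚ-cong (cong f ∘ next-inject₁)) (cong f next-last) ⟩
    Σℚ (f ∘ Fin.suc) + f Fin.zero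
      ≡⟨ ℚ.+-comm _ (f Fin.zero) ⟩
    f Fin.zero + Σℚ (f ∘ Fin.suc)
      ≡⟨ Σℚ-suc f ⟨
    Σℚ f ∎
    where
    open ≡-Reasoning
    next-inject₁ : ∀ i → next (Fin.inject₁ i) ≡ Fin.suc i
    next-inject₁ i = sym (CycNext⇒≡next (inj₁ (cong suc (Fin.toℕ-inject₁ i))))
    next-last : next (Fin.fromℕ m) ≡ Fin.zero
    next-last = sym (CycNext⇒≡next (inj₂ (cong suc (Fin.toℕ-fromℕ m) , refl)))

  oddCycle-not-2-colourable : ∀ {m} → Odd m → (c : Fin m → Fin 2) →
                              ¬ (∀ i j → CycNext m i j → c i ≢ c j)
  oddCycle-not-2-colourable {m} (k , refl) c proper =
    proper last Fin.zero last→0 (evenPosition (2 ℕ.* k) (ℕ.n<1+n _) (ℙ.*-homo-* 2 k))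
    where
    last : Fin m
    last = fromℕ< (ℕ.n<1+n (2 ℕ.* k))
    last→0 : CycNext m last Fin.zero
    last→0 = inj₂ (cong suc (Fin.toℕ-fromℕ< _) , refl)
    consecutive : ∀ t (t+1<m : suc t ℕ.< m) → c (fromℕ< (ℕ.<-trans (ℕ.n<1+n t) t+1<m)) ≢ c (fromℕ< t+1<m)
    consecutive t t+1<m = proper _ _ (inj₁ (trans (cong suc (Fin.toℕ-fromℕ< _)) (sym (Fin.toℕ-fromℕ< t+1<m))))
    evenPosition : ∀ t (t<m : t ℕ.< m) → parity t ≡ 0ℙ → c (fromℕ< t<m) ≡ c Fin.zero
    evenPosition zero          _      _    = refl
    evenPosition (suc (suc t)) t+2<m even =
      trans (sym (Fin2-≢-≢⇒≡ (consecutive t t+1<m) (consecutive (suc t) t+2<m))) (evenPosition t t<m even)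
      where
      t+1<m = ℕ.<-trans (ℕ.n<1+n (suc t)) t+2<m
      t<m = ℕ.<-trans (ℕ.n<1+n t) t+1<m

  cycleColour-proper : ∀ {m} → 2 ℕ.≤ m → ∀ (i j : Fin m) → CycNext m i j →
                       cycleColour (toℕ i) ≢ cycleColour (toℕ j)
  cycleColour-proper _ i j (inj₁ i+1≡j) =
    subst (λ t → cycleColour (toℕ i) ≢ cycleColour t) i+1≡j (step (toℕ i))
    where
    step : ∀ t → cycleColour t ≢ cycleColour (suc t)
    step zero    = λ ()
    step (suc t) = alternating-suc (suc t)
  cycleColour-proper {m} m≥2 i j (inj₂ (i+1≡m , j≡0)) =
    subst (λ t → cycleColour (toℕ i) ≢ cycleColour t) (sym j≡0) (wrap (toℕ i) i+1≡m)
    where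
    wrap : ∀ t → suc t ≡ m → cycleColour t ≢ cycleColour 0
    wrap zero    1≡m = ⊥-elim (ℕ.<-irrefl 1≡m m≥2)
    wrap (suc t) _   = alternating≢2 (suc t)

  Fin3-≢⇒CycNext : ∀ (i j : Fin 3) → i ≢ j → CycNext 3 i j ⊎ CycNext 3 j i
  Fin3-≢⇒CycNext 0F 0F i≢j = ⊥-elim (i≢j refl)
  Fin3-≢⇒CycNext 0F 1F _   = inj₁ (inj₁ refl)
  Fin3-≢⇒CycNext 0F 2F _   = inj₂ (inj₂ (refl , refl))
  Fin3-≢⇒CycNext 1F 0F _   = inj₂ (inj₁ refl)
  Fin3-≢⇒CycNext 1F 1F i≢j = ⊥-elim (i≢j refl)
  Fin3-≢⇒CycNext 1F 2F _   = inj₁ (inj₁ refl)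
  Fin3-≢⇒CycNext 2F 0F _   = inj₁ (inj₂ (refl , refl))
  Fin3-≢⇒CycNext 2F 1F _   = inj₂ (inj₁ refl)
  Fin3-≢⇒CycNext 2F 2F i≢j = ⊥-elim (i≢j refl)

  module _ (Adj-irrefl : ∀ {u} → ¬ Adj u u) where

    triangle : ∀ {a b c} → Adj a b → Adj b c → Adj c a → InducedOddCycle
    triangle {a} {b} {c} ab bc ca = record
      { cyc     = record { len = 3 ; len≥3 = ℕ.≤-refl ; odd = 1 , refl
                         ; vert = corner ; inj = corner-injective ; edges = edges }
      ; induced = λ i j adj → Fin3-≢⇒CycNext i j (λ { refl → Adj-irrefl adj })
      }
      where
      corner : Fin 3 → Fin n
      corner 0F = a
      corner 1F = b
      corner 2F = c
      side : ∀ i → Adj (corner i) (corner (next i))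
      side 0F = ab
      side 1F = bc
      side 2F = ca
      edges : ∀ i j → CycNext 3 i j → Adj (corner i) (corner j)
      edges i j i→j = subst (Adj (corner i) ∘ corner) (sym (CycNext⇒≡next i→j)) (side i)
      corner-injective : ∀ i j → corner i ≡ corner j → i ≡ j
      corner-injective i j eq with i Fin.≟ j
      ... | yes i≡j = i≡j
      ... | no  i≢j with Fin3-≢⇒CycNext i j i≢j
      ...   | inj₁ i→j = ⊥-elim (Adj-irrefl (subst (λ v → Adj v (corner j)) eq (edges i j i→j)))
      ...   | inj₂ j→i = ⊥-elim (Adj-irrefl (subst (Adj (corner j)) eq (edges j i j→i)))

  χvec-IsInteger : ∀ S v → IsInteger (χvec S v)
  χvec-IsInteger S v with S v
  ... | true  = ℤ.1ℤ , refl
  ... | false = ℤ.0ℤ , refl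

  χvec-edge≤1 : ∀ {S} → Stable S → ∀ {u v} → Adj u v → χvec S u + χvec S v ≤ 1ℚ
  χvec-edge≤1 {S} S-stable {u} {v} uv with S u in u∈S
  ... | true rewrite S-stable u v uv u∈S = from-yes (1ℚ + 0ℚ ℚ.≤? 1ℚ)
  ... | false with S v
  ...   | true  = from-yes (0ℚ + 1ℚ ℚ.≤? 1ℚ)
  ...   | false = from-yes (0ℚ + 0ℚ ℚ.≤? 1ℚ)

  stable-oddCycle-bound : ∀ {S} → Stable S → (C : OddCycle) →
                          Σℚ (χvec S ∘ OddCycle.vert C) ≤ ℕtoℚ (proj₁ (OddCycle.odd C))
  stable-oddCycle-bound {S} S-stable C with OddCycle.odd C
  ... | k , len≡ = IsInteger-<1+⇒≤ X-IsInteger (ℤ.+ k , refl) (p+p<q+q⇒p<q X+X<[1+K]+[1+K])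
    where
    open OddCycle C
    X = Σℚ (χvec S ∘ vert)
    K = ℕtoℚ k
    X-IsInteger : IsInteger X
    X-IsInteger = sumℚ-IsInteger (allFin len) (All.universal (χvec-IsInteger S ∘ vert) (allFin len))
    edge≤1 : ∀ i → χvec S (vert i) + χvec S (vert (next i)) ≤ 1ℚ
    edge≤1 i = χvec-edge≤1 S-stable (edges i (next i) (CycNext-next i))
    X+X<[1+K]+[1+K] : X + X < (1ℚ + K) + (1ℚ + K)
    X+X<[1+K]+[1+K] = begin-strict
      X + X
        ≡⟨ cong (X +_) (Σℚ-next (χvec S ∘ vert)) ⟨
      X + Σℚ (χvec S ∘ vert ∘ next)
        ≡⟨ sumℚ-map-+ (χvec S ∘ vert) (χvec S ∘ vert ∘ next) (allFin len) ⟨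
      Σℚ (λ i → χvec S (vert i) + χvec S (vert (next i)))
        ≤⟨ sumℚ-map-mono-≤ (allFin len) (All.universal edge≤1 (allFin len)) ⟩
      Σℚ {len} (λ _ → 1ℚ)
        ≡⟨ trans (Σℚ-const len 1ℚ) (ℚ.*-identityʳ _) ⟩
      ℕtoℚ len
        <⟨ p<1+p (ℕtoℚ len) ⟩
      1ℚ + ℕtoℚ len
        ≡⟨ ℕtoℚ-+ 1 len ⟨
      ℕtoℚ (suc len)
        ≤⟨ ℕtoℚ-mono-≤ (ℕ.≤-reflexive (trans (cong suc len≡) (2+2k≡[1+k]+[1+k] k))) ⟩
      ℕtoℚ (suc k ℕ.+ suc k)
        ≡⟨ trans (ℕtoℚ-+ (suc k) (suc k)) (cong₂ _+_ (ℕtoℚ-+ 1 k) (ℕtoℚ-+ 1 k)) ⟩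
      (1ℚ + K) + (1ℚ + K) ∎
      where
      open ℚ.≤-Reasoning
      2+2k≡[1+k]+[1+k] : ∀ k → suc (suc (2 ℕ.* k)) ≡ suc k ℕ.+ suc k
      2+2k≡[1+k]+[1+k] = solve-∀

module Polyhedra {n : ℕ} (Adj : Fin n → Fin n → Set) where
  open GraphNotions Adj

  ·-comm : ∀ a b → a · b ≡ b · a
  ·-comm a b = Σℚ-cong (λ v → ℚ.*-comm (a v) (b v))

  ·-+ˡ : ∀ a b q → (λ v → a v + b v) · q ≡ a · q + b · q
  ·-+ˡ a b q = trans (Σℚ-cong (λ v → ℚ.*-distribʳ-+ (q v) (a v) (b v)))
                     (sumℚ-map-+ (λ v → a v * q v) (λ v → b v * q v) (allFin n))

  ·-*ˡ : ∀ c a q → (λ v → c * a v) · q ≡ c * (a · q)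
  ·-*ˡ c a q = trans (Σℚ-cong (λ v → ℚ.*-assoc c (a v) (q v)))
                     (sumℚ-map-*ˡ c (λ v → a v * q v) (allFin n))

  ·-negˡ : ∀ a q → (λ v → - a v) · q ≡ - (a · q)
  ·-negˡ a q = begin
    (λ v → - a v) · q           ≡⟨ Σℚ-cong (λ v → cong (_* q v) (-p≡-1*p (a v))) ⟩
    (λ v → - 1ℚ * a v) · q      ≡⟨ ·-*ˡ (- 1ℚ) a q ⟩
    - 1ℚ * (a · q)              ≡⟨ -p≡-1*p (a · q) ⟨
    - (a · q)                   ∎
    where
    open ≡-Reasoning
    -p≡-1*p : ∀ p → - p ≡ - 1ℚ * p
    -p≡-1*p p = trans (cong -_ (sym (ℚ.*-identityˡ p))) (ℚ.neg-distribˡ-* 1ℚ p)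

  ·-sumˡ : ∀ {A : Set} (a : A → Vect) xs q →
           (λ v → sumℚ (map (λ c → a c v) xs)) · q ≡ sumℚ (map (λ c → a c · q) xs)
  ·-sumˡ a xs q = trans (Σℚ-cong (λ v → sym (sumℚ-map-*ʳ (q v) (λ c → a c v) xs)))
                        (sumℚ-map-swap (λ v c → a c v * q v) (allFin n) xs)

  Σδ· : ∀ {m} (f : Fin m → Fin n) q → (λ v → Σℚ (λ i → δ (f i) v)) · q ≡ Σℚ (q ∘ f)
  Σδ· {m} f q = trans (·-sumˡ (δ ∘ f) (allFin m) q) (Σℚ-cong (λ i → Σℚ-δ (f i) q))

  row·≤rhs : ∀ {p} → TSTAB p → ∀ c → row c · p ≤ rhs c
  row·≤rhs {p} (p≥0 , _ , _) (nonneg v) = begin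
    (λ w → - δ v w) · p  ≡⟨ ·-negˡ (δ v) p ⟩
    - (δ v · p)          ≡⟨ cong -_ (Σℚ-δ v p) ⟩
    - p v                ≤⟨ ℚ.neg-antimono-≤ (p≥0 v) ⟩
    0ℚ                   ∎
    where open ℚ.≤-Reasoning
  row·≤rhs {p} (_ , edge≤1 , _) (edge u v uv) = begin
    (λ w → δ u w + δ v w) · p  ≡⟨ ·-+ˡ (δ u) (δ v) p ⟩
    δ u · p + δ v · p          ≡⟨ cong₂ _+_ (Σℚ-δ u p) (Σℚ-δ v p) ⟩
    p u + p v                  ≤⟨ edge≤1 u v uv ⟩
    1ℚ                         ∎
    where open ℚ.≤-Reasoning
  row·≤rhs {p} (_ , _ , cycle≤) (oddcyc C) =
    ℚ.≤-trans (ℚ.≤-reflexive (Σδ· (InducedOddCycle.vert C) p)) (cycle≤ C)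

  weakDuality : ∀ {p} → TSTAB p → ∀ w y → DualFeasible w y → (ℤtoℚ ∘ w) · p ≤ dualValue y
  weakDuality {p} p∈TSTAB w y (y≥0 , y·row≡w) = begin
    (ℤtoℚ ∘ w) · p
      ≡⟨ Σℚ-cong (λ v → cong (_* p v) (sym (y·row≡w v))) ⟩
    (λ v → sumℚ (map (λ (c , λc) → λc * row c v) y)) · p
      ≡⟨ ·-sumˡ (λ (c , λc) v → λc * row c v) y p ⟩
    sumℚ (map (λ (c , λc) → (λ v → λc * row c v) · p) y)
      ≡⟨ sumℚ-map-cong y (λ (c , λc) → ·-*ˡ λc (row c) p) ⟩
    sumℚ (map (λ (c , λc) → λc * (row c · p)) y)
      ≤⟨ sumℚ-weighted-mono-≤ proj₂ y y≥0 (λ (c , _) → row·≤rhs p∈TSTAB c) ⟩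
    dualValue y ∎
    where open ℚ.≤-Reasoning

  SSP-bounded : ∀ (w : Vect) K → (∀ S → Stable S → w · χvec S ≤ K) → ∀ {p} → SSP p → w · p ≤ K
  SSP-bounded w K stable≤K {p} (L , λ≥0 , Σλ≡1 , p≡) = begin
    w · p
      ≡⟨ Σℚ-cong (λ v → cong (w v *_) (p≡ v)) ⟩
    w · (λ v → sumℚ (map (λ (S , λS) → λS * χvec (proj₁ S) v) L))
      ≡⟨ ·-comm w _ ⟩
    (λ v → sumℚ (map (λ (S , λS) → λS * χvec (proj₁ S) v) L)) · w
      ≡⟨ ·-sumˡ (λ (S , λS) v → λS * χvec (proj₁ S) v) L w ⟩
    sumℚ (map (λ (S , λS) → (λ v → λS * χvec (proj₁ S) v) · w) L)
      ≡⟨ sumℚ-map-cong L (λ (S , λS) → trans (·-*ˡ λS (χvec (proj₁ S)) w) (cong (λS *_) (·-comm _ w))) ⟩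
    sumℚ (map (λ (S , λS) → λS * (w · χvec (proj₁ S))) L)
      ≤⟨ sumℚ-weighted-mono-≤ proj₂ L λ≥0 (λ ((S , S-stable) , _) → stable≤K S S-stable) ⟩
    sumℚ (map (λ (_ , λS) → λS * K) L)
      ≡⟨ sumℚ-map-*ʳ K proj₂ L ⟩
    sumℚ (map proj₂ L) * K
      ≡⟨ cong (_* K) Σλ≡1 ⟩
    1ℚ * K
      ≡⟨ ℚ.*-identityˡ K ⟩
    K ∎
    where open ℚ.≤-Reasoning

  ⅓∈TSTAB : TSTAB (λ _ → ⅓)
  ⅓∈TSTAB = (λ _ → from-yes (0ℚ ℚ.≤? ⅓))
          , (λ _ _ _ → from-yes (⅓ + ⅓ ℚ.≤? 1ℚ))
          , λ C → let open InducedOddCycle C in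
              ℚ.≤-trans (ℚ.≤-reflexive (Σℚ-const len ⅓)) (third≤half len (ℕ.≤-trans (ℕ.n≤1+n 2) len≥3))

  dualValue-IsInteger : ∀ y → Integral y → IsInteger (dualValue y)
  dualValue-IsInteger y y-integral =
    sumℚ-IsInteger y (All.map (λ {(c , _)} λc∈ℤ → IsInteger-* λc∈ℤ (rhs-IsInteger c)) y-integral)
    where
    rhs-IsInteger : ∀ c → IsInteger (rhs c)
    rhs-IsInteger (nonneg _)   = ℤ.0ℤ , refl
    rhs-IsInteger (edge _ _ _) = ℤ.1ℤ , refl
    rhs-IsInteger (oddcyc C)   = ℤ.+ (InducedOddCycle.len C / 2) , refl

module OddWheels {n : ℕ} (Adj : Fin n → Fin n → Set)
                 (Adj-sym : ∀ {u v} → Adj u v → Adj v u) (Adj-irrefl : ∀ {u} → ¬ Adj u u) where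
  open GraphNotions Adj
  open CycleNotions Adj
  open Polyhedra Adj

  record OddWheel : Set where
    field
      hub   : Fin n
      rim   : InducedOddCycle
      spoke : ∀ i → Adj hub (InducedOddCycle.vert rim i)

  module _ (W : OddWheel) where
    open OddWheel W
    open InducedOddCycle rim

    oddWheel⇒LooseOddWheel : LooseOddWheel
    oddWheel⇒LooseOddWheel with threeOddGaps len≥3 odd
    ... | i , j , l , i<j , j<l , odd₁ , odd₂ , odd₃ =
      cyc , hub , rim≢hub , i , j , l , i<j , j<l , spoke i , spoke j , spoke l , odd₁ , odd₂ , odd₃
      where
      rim≢hub : ∀ i → vert i ≢ hub
      rim≢hub i eq = Adj-irrefl (subst (Adj hub) eq (spoke i))

    InWheel : Fin n → Set
    InWheel v = hub ≡ v ⊎ ∃ λ i → vert i ≡ v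

    inWheel? : ∀ v → Dec (InWheel v)
    inWheel? v = (hub Fin.≟ v) ⊎-dec Fin.any? (λ i → vert i Fin.≟ v)

    wheel : Fin n → Bool
    wheel v = isYes (inWheel? v)

    hub∈wheel : wheel hub ≡ true
    hub∈wheel = Equivalence.to T-≡ (fromWitness (inj₁ refl))

    rim∈wheel : ∀ i → wheel (vert i) ≡ true
    rim∈wheel i = Equivalence.to T-≡ (fromWitness (inj₂ (i , refl)))

    wheelColour : ∀ {v} → InWheel v → Fin 4
    wheelColour (inj₁ _)       = 3F
    wheelColour (inj₂ (i , _)) = Fin.inject₁ (cycleColour (toℕ i))

    wheelColour-proper : ∀ {u v} (u∈ : InWheel u) (v∈ : InWheel v) → Adj u v → wheelColour u∈ ≢ wheelColour v∈
    wheelColour-proper (inj₁ refl) (inj₁ refl) uv = ⊥-elim (Adj-irrefl uv)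
    wheelColour-proper (inj₁ _) (inj₂ _) _ = Fin.fromℕ≢inject₁
    wheelColour-proper (inj₂ _) (inj₁ _) _ = Fin.fromℕ≢inject₁ ∘ sym
    wheelColour-proper (inj₂ (i , refl)) (inj₂ (j , refl)) ij =
      [ proper i j , (λ j→i → proper j i j→i ∘ sym) ]′ (induced i j ij) ∘ Fin.inject₁-injective
      where proper = cycleColour-proper (ℕ.≤-trans (ℕ.n≤1+n 2) len≥3)

    wheel-4-colouring : Colouring wheel 4
    wheel-4-colouring = (λ v v∈ → wheelColour (inWheel v∈))
                      , (λ u v u∈ v∈ → wheelColour-proper (inWheel u∈) (inWheel v∈))
      where
      inWheel : ∀ {v} → wheel v ≡ true → InWheel v
      inWheel {v} v∈ = toWitness {a? = inWheel? v} (Equivalence.from T-≡ v∈)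

    wheel-not-3-colourable : ∀ m → Colouring wheel m → 4 ℕ.≤ m
    wheel-not-3-colourable zero    (c , _) with c hub hub∈wheel
    ... | ()
    wheel-not-3-colourable (suc m) (c , proper) with 4 ℕ.≤? suc m
    ... | yes 4≤m+1 = 4≤m+1
    ... | no  4≰m+1 = ⊥-elim (oddCycle-not-2-colourable odd rimColour rimColour-proper)
      where
      m≤2 : m ℕ.≤ 2
      m≤2 = ℕ.s≤s⁻¹ (ℕ.s≤s⁻¹ (ℕ.≰⇒> 4≰m+1))
      hub≢rim : ∀ i → c hub hub∈wheel ≢ c (vert i) (rim∈wheel i)
      hub≢rim i = proper hub (vert i) hub∈wheel (rim∈wheel i) (spoke i)
      -- Deleting the hub's colour leaves at most 2 colours for the rim.
      rimColour : Fin len → Fin 2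
      rimColour i = Fin.inject≤ (Fin.punchOut (hub≢rim i)) m≤2
      rimColour-proper : ∀ i j → CycNext len i j → rimColour i ≢ rimColour j
      rimColour-proper i j i→j =
        proper (vert i) (vert j) (rim∈wheel i) (rim∈wheel j) (edges i j i→j)
        ∘ Fin.punchOut-injective (hub≢rim i) (hub≢rim j)
        ∘ Fin.inject≤-injective m≤2 m≤2 _ _

    oddWheel⇒¬Perfect×K4Free : ¬ (Perfect × K4Free)
    oddWheel⇒¬Perfect×K4Free (perfect , K4-free)
      with perfect wheel 4 (wheel-4-colouring , wheel-not-3-colourable)
    ... | (f , _ , _ , f-clique) , _ = K4-free (f , f-clique)

    k : ℕ
    k = proj₁ odd

    K : ℚ
    K = ℕtoℚ k

    len≡1+K+K : ℕtoℚ len ≡ 1ℚ + (K + K)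
    len≡1+K+K = begin
      ℕtoℚ len                    ≡⟨ cong ℕtoℚ (proj₂ odd) ⟩
      ℕtoℚ (1 ℕ.+ (k ℕ.+ (k ℕ.+ 0))) ≡⟨ ℕtoℚ-+ 1 (k ℕ.+ (k ℕ.+ 0)) ⟩
      1ℚ + ℕtoℚ (k ℕ.+ (k ℕ.+ 0))   ≡⟨ cong (λ m → 1ℚ + ℕtoℚ (k ℕ.+ m)) (ℕ.+-identityʳ k) ⟩
      1ℚ + ℕtoℚ (k ℕ.+ k)           ≡⟨ cong (1ℚ +_) (ℕtoℚ-+ k k) ⟩
      1ℚ + (K + K)                  ∎
      where open ≡-Reasoning

    weightℚ : Vect
    weightℚ v = K * δ hub v + Σℚ (λ i → δ (vert i) v)

    weightℚ-IsInteger : ∀ v → IsInteger (weightℚ v)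
    weightℚ-IsInteger v =
      IsInteger-+ (IsInteger-* (ℤ.+ k , refl) (δ-IsInteger hub v))
                  (sumℚ-IsInteger (allFin len) (All.universal (λ i → δ-IsInteger (vert i) v) (allFin len)))

    weight : Fin n → ℤ
    weight v = proj₁ (weightℚ-IsInteger v)

    weightℚ·≡ : ∀ q → weightℚ · q ≡ K * q hub + Σℚ (q ∘ vert)
    weightℚ·≡ q = begin
      weightℚ · q
        ≡⟨ ·-+ˡ (λ v → K * δ hub v) _ q ⟩
      (λ v → K * δ hub v) · q + (λ v → Σℚ (λ i → δ (vert i) v)) · q
        ≡⟨ cong₂ _+_ (·-*ˡ K (δ hub) q) (Σδ· vert q) ⟩
      K * (δ hub · q) + Σℚ (q ∘ vert)
        ≡⟨ cong (λ x → K * x + Σℚ (q ∘ vert)) (Σℚ-δ hub q) ⟩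
      K * q hub + Σℚ (q ∘ vert) ∎
      where open ≡-Reasoning

    weight·≡weightℚ· : ∀ q → (ℤtoℚ ∘ weight) · q ≡ weightℚ · q
    weight·≡weightℚ· q = Σℚ-cong (λ v → cong (_* q v) (sym (proj₂ (weightℚ-IsInteger v))))

    weightℚ·⅓ : weightℚ · (λ _ → ⅓) ≡ K + ⅓
    weightℚ·⅓ = begin
      weightℚ · (λ _ → ⅓)          ≡⟨ weightℚ·≡ (λ _ → ⅓) ⟩
      K * ⅓ + Σℚ {len} (λ _ → ⅓)   ≡⟨ cong (K * ⅓ +_) (trans (Σℚ-const len ⅓) (cong (_* ⅓) len≡1+K+K)) ⟩
      K * ⅓ + (1ℚ + (K + K)) * ⅓   ≡⟨ solve 1 (λ K → K :* con ⅓ :+ (con 1ℚ :+ (K :+ K)) :* con ⅓ := K :+ con ⅓) refl K ⟩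
      K + ⅓                        ∎
      where
      open ≡-Reasoning
      open +-*-Solver

    weightℚ·stable≤K : ∀ S → Stable S → weightℚ · χvec S ≤ K
    weightℚ·stable≤K S S-stable = ℚ.≤-trans (ℚ.≤-reflexive (weightℚ·≡ (χvec S))) (bound (S hub) refl)
      where
      bound : ∀ b → S hub ≡ b → K * χvec S hub + Σℚ (χvec S ∘ vert) ≤ K
      bound true hub∈S = ℚ.≤-reflexive (begin
        K * χvec S hub + Σℚ (χvec S ∘ vert)    ≡⟨ cong₂ _+_ (cong (λ b → K * (if b then 1ℚ else 0ℚ)) hub∈S) (Σℚ-cong rim∉S) ⟩
        K * 1ℚ + Σℚ {len} (λ _ → 0ℚ)           ≡⟨ cong₂ _+_ (ℚ.*-identityʳ K) (sumℚ-map-0 (allFin len)) ⟩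
        K + 0ℚ                                 ≡⟨ ℚ.+-identityʳ K ⟩
        K                                      ∎)
        where
        open ≡-Reasoning
        rim∉S : ∀ i → χvec S (vert i) ≡ 0ℚ
        rim∉S i = cong (λ b → if b then 1ℚ else 0ℚ) (S-stable hub (vert i) (spoke i) hub∈S)
      bound false hub∉S = begin
        K * χvec S hub + Σℚ (χvec S ∘ vert)    ≡⟨ cong (λ b → K * (if b then 1ℚ else 0ℚ) + Σℚ (χvec S ∘ vert)) hub∉S ⟩
        K * 0ℚ + Σℚ (χvec S ∘ vert)            ≡⟨ trans (cong (_+ Σℚ (χvec S ∘ vert)) (ℚ.*-zeroʳ K)) (ℚ.+-identityˡ _) ⟩
        Σℚ (χvec S ∘ vert)                     ≤⟨ stable-oddCycle-bound S-stable cyc ⟩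
        K                                      ∎
        where open ℚ.≤-Reasoning

    K<K+⅓ : K < K + ⅓
    K<K+⅓ = begin-strict
      K         ≡⟨ ℚ.+-identityʳ K ⟨
      K + 0ℚ    <⟨ ℚ.+-monoʳ-< K (from-yes (0ℚ ℚ.<? ⅓)) ⟩
      K + ⅓     ∎
      where open ℚ.≤-Reasoning

    ⅓∉SSP : ¬ SSP (λ _ → ⅓)
    ⅓∉SSP ⅓∈SSP = ℚ.<-irrefl refl (begin-strict
      K                      <⟨ K<K+⅓ ⟩
      K + ⅓                  ≡⟨ weightℚ·⅓ ⟨
      weightℚ · (λ _ → ⅓)    ≤⟨ SSP-bounded weightℚ K weightℚ·stable≤K ⅓∈SSP ⟩
      K                      ∎)
      where open ℚ.≤-Reasoning

    oddWheel⇒¬TPerfect : ¬ TPerfect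
    oddWheel⇒¬TPerfect t-perfect = ⅓∉SSP (Equivalence.from (t-perfect _) ⅓∈TSTAB)

    spokeTriangle : Fin len → InducedOddCycle
    spokeTriangle i = triangle Adj-irrefl (spoke i) (edges i (next i) (CycNext-next i)) (Adj-sym (spoke (next i)))

    triangleDual : DualSol
    triangleDual = (nonneg hub , ½) ∷ map (λ i → oddcyc (spokeTriangle i) , ½) (allFin len)

    triangleDual-feasible : DualFeasible weight triangleDual
    triangleDual-feasible = ½≥0 ∷ map⁺ (All.universal (λ _ → ½≥0) (allFin len)) , covers
      where
      ½≥0 : 0ℚ ≤ ½
      ½≥0 = from-yes (0ℚ ℚ.≤? ½)
      covers : ∀ v → sumℚ (map (λ (c , λc) → λc * row c v) triangleDual) ≡ ℤtoℚ (weight v)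
      covers v = begin
        ½ * (- d) + sumℚ (map (λ (c , λc) → λc * row c v) (map (λ i → oddcyc (spokeTriangle i) , ½) (allFin len)))
          ≡⟨ cong (λ xs → ½ * (- d) + sumℚ xs) (sym (List.map-∘ (allFin len))) ⟩
        ½ * (- d) + Σℚ (λ i → ½ * (d + (δ (vert i) v + (δ (vert (next i)) v + 0ℚ))))
          ≡⟨ cong (λ x → ½ * (- d) + x) (sumℚ-map-*ˡ ½ _ (allFin len)) ⟩
        ½ * (- d) + ½ * Σℚ (λ i → d + (δ (vert i) v + (δ (vert (next i)) v + 0ℚ)))
          ≡⟨ cong (λ x → ½ * (- d) + ½ * x) spokeSum ⟩
        ½ * (- d) + ½ * ((1ℚ + (K + K)) * d + (A + A))
          ≡⟨ solve 3 (λ d K A → con ½ :* (:- d) :+ con ½ :* ((con 1ℚ :+ (K :+ K)) :* d :+ (A :+ A)) := K :* d :+ A) refl d K A ⟩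
        K * d + A
          ≡⟨ proj₂ (weightℚ-IsInteger v) ⟩
        ℤtoℚ (weight v) ∎
        where
        open ≡-Reasoning
        open +-*-Solver
        d = δ hub v
        A = Σℚ (λ i → δ (vert i) v)
        spokeSum : Σℚ (λ i → d + (δ (vert i) v + (δ (vert (next i)) v + 0ℚ))) ≡ (1ℚ + (K + K)) * d + (A + A)
        spokeSum = begin
          Σℚ (λ i → d + (δ (vert i) v + (δ (vert (next i)) v + 0ℚ)))
            ≡⟨ Σℚ-cong (λ i → cong (λ x → d + (δ (vert i) v + x)) (ℚ.+-identityʳ _)) ⟩
          Σℚ (λ i → d + (δ (vert i) v + δ (vert (next i)) v))
            ≡⟨ sumℚ-map-+ (λ _ → d) _ (allFin len) ⟩
          Σℚ {len} (λ _ → d) + Σℚ (λ i → δ (vert i) v + δ (vert (next i)) v)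
            ≡⟨ cong₂ _+_ (Σℚ-const len d) (sumℚ-map-+ (λ i → δ (vert i) v) (λ i → δ (vert (next i)) v) (allFin len)) ⟩
          ℕtoℚ len * d + (A + Σℚ (λ i → δ (vert (next i)) v))
            ≡⟨ cong₂ (λ L x → L * d + (A + x)) len≡1+K+K (Σℚ-next (λ i → δ (vert i) v)) ⟩
          (1ℚ + (K + K)) * d + (A + A) ∎

    triangleDual-value : dualValue triangleDual ≡ K + ½
    triangleDual-value = begin
      ½ * 0ℚ + sumℚ (map (λ (c , λc) → λc * rhs c) (map (λ i → oddcyc (spokeTriangle i) , ½) (allFin len)))
        ≡⟨ cong (λ xs → ½ * 0ℚ + sumℚ xs) (sym (List.map-∘ (allFin len))) ⟩
      ½ * 0ℚ + Σℚ {len} (λ _ → ½ * 1ℚ)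
        ≡⟨ cong (½ * 0ℚ +_) (trans (Σℚ-const len (½ * 1ℚ)) (cong (_* (½ * 1ℚ)) len≡1+K+K)) ⟩
      ½ * 0ℚ + (1ℚ + (K + K)) * (½ * 1ℚ)
        ≡⟨ solve 1 (λ K → con ½ :* con 0ℚ :+ (con 1ℚ :+ (K :+ K)) :* (con ½ :* con 1ℚ) := K :+ con ½) refl K ⟩
      K + ½ ∎
      where
      open ≡-Reasoning
      open +-*-Solver

    oddWheel⇒¬StronglyTPerfect : ¬ StronglyTPerfect
    oddWheel⇒¬StronglyTPerfect strongly-t-perfect with strongly-t-perfect weight
    ... | y , (y-feasible , y-optimal) , y-integral =
      ℚ.<-irrefl refl (ℚ.<-≤-trans K<y (IsInteger-<1+⇒≤ (dualValue-IsInteger y y-integral) (ℤ.+ k , refl) y<1+K))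
      where
      open ℚ.≤-Reasoning
      K<y : K < dualValue y
      K<y = begin-strict
        K                           <⟨ K<K+⅓ ⟩
        K + ⅓                       ≡⟨ weightℚ·⅓ ⟨
        weightℚ · (λ _ → ⅓)         ≡⟨ weight·≡weightℚ· (λ _ → ⅓) ⟨
        (ℤtoℚ ∘ weight) · (λ _ → ⅓) ≤⟨ weakDuality ⅓∈TSTAB weight y y-feasible ⟩
        dualValue y                 ∎
      y<1+K : dualValue y < 1ℚ + K
      y<1+K = begin-strict
        dualValue y                 ≤⟨ y-optimal triangleDual triangleDual-feasible ⟩
        dualValue triangleDual      ≡⟨ triangleDual-value ⟩
        K + ½                       <⟨ ℚ.+-monoʳ-< K (from-yes (½ ℚ.<? 1ℚ)) ⟩
        K + 1ℚ                      ≡⟨ ℚ.+-comm K 1ℚ ⟩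
        1ℚ + K                      ∎

module _ {n : ℕ} (Adj : Fin n → Fin n → Set) (Adj? : ∀ u v → Dec (Adj u v))
         (Adj-sym : ∀ {u v} → Adj u v → Adj v u) (Adj-irrefl : ∀ {u} → ¬ Adj u u) (x : Fin n) where
  open GraphNotions Adj
  open OddWheels Adj Adj-sym Adj-irrefl

  NeighbourhoodAdj : Fin n → Fin n → Set
  NeighbourhoodAdj u w = Adj x u × Adj x w × Adj u w

  nonBipartiteNeighbourhood⇒OddWheel : ¬ NeighbourhoodBipartite x → OddWheel
  nonBipartiteNeighbourhood⇒OddWheel not-bipartite = record { hub = x ; rim = rim ; spoke = spoke }
    where
    C : GraphNotions.InducedOddCycle NeighbourhoodAdj
    C = Walks.nonBipartite⇒InducedOddCycle NeighbourhoodAdj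
          (λ u w → Adj? x u ×-dec Adj? x w ×-dec Adj? u w)
          (λ (xu , xw , uw) → xw , xu , Adj-sym uw) (λ (_ , _ , uu) → Adj-irrefl uu)
          (λ (colour , proper) → not-bipartite (colour , λ u w xu xw uw → proper u w (xu , xw , uw)))
    open GraphNotions.InducedOddCycle C
    spoke : ∀ i → Adj x (vert i)
    spoke i = proj₁ (edges i (next i) (CycleNotions.CycNext-next Adj i))
    rim : InducedOddCycle
    rim = record
      { cyc     = record { len = len ; len≥3 = len≥3 ; odd = odd ; vert = vert ; inj = inj
                         ; edges = λ i j i→j → proj₂ (proj₂ (edges i j i→j)) }
      ; induced = λ i j ij → induced i j (spoke i , spoke j , ij)
      }

module _ {n : ℕ} {faces : List (Face n)} where

  FAdj? : ∀ u v → Dec (FAdj faces u v)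
  FAdj? u v = ¬? (u Fin.≟ v) ×-dec map′ find (λ (_ , f∈ , uv∈f) → lose f∈ uv∈f)
                                      (any? (λ f → ∈F? u f ×-dec ∈F? v f) faces)
    where
    ∈F? : ∀ w (f : Face n) → Dec (w ∈F f)
    ∈F? w (a , b , c) = (w Fin.≟ a) ⊎-dec (w Fin.≟ b) ⊎-dec (w Fin.≟ c)

  FAdj-sym : ∀ {u v} → FAdj faces u v → FAdj faces v u
  FAdj-sym (u≢v , f , f∈ , u∈f , v∈f) = u≢v ∘ sym , f , f∈ , v∈f , u∈f

  FAdj-irrefl : ∀ {u} → ¬ FAdj faces u u
  FAdj-irrefl (u≢u , _) = u≢u refl

mainTheorem5 : (G : Triangulation) → (x : Fin (Triangulation.n G)) →
    let open GraphNotions (Triangulation.Adj G) in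
    ¬ NeighbourhoodBipartite x →
    (¬ TPerfect) × (¬ StronglyTPerfect) × (¬ (Perfect × K4Free))
    × (LooseOddWheel ⊎ InducedC7bar)
mainTheorem5 G x not-bipartite =
  oddWheel⇒¬TPerfect W , oddWheel⇒¬StronglyTPerfect W ,
  oddWheel⇒¬Perfect×K4Free W , inj₁ (oddWheel⇒LooseOddWheel W)
  where
  open Triangulation G
  open OddWheels Adj FAdj-sym FAdj-irrefl
  W : OddWheel
  W = nonBipartiteNeighbourhood⇒OddWheel Adj FAdj? FAdj-sym FAdj-irrefl x not-bipartite
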